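{- Let $g:\mathbb{Z}_n\to\mathbb{Z}_n$ satisfy $|g^{(n-1)}(\mathbb{Z}_n)|=1$ and suppose $G_g$ is $\vec{\beta}$-labeled, i.e. $\{(-1)^{d_g(v)}(g(v)-v):v\in\mathbb{Z}_n\}=\mathbb{Z}_n$. Then the directed bipartite tree $\vec{G}_{g,g^\top}$ cyclically decomposes $\vec{K}_{n,n}$: the $n$ shifted copies $E_i=\{(x+i \bmod n,\ n+(y+i\bmod n)):(x,n+y)\in E(\vec G_{g,g^\top})\}$, $i\in\mathbb{Z}_n$, are pairwise disjoint and their union is $\mathbb{Z}_n\times(\mathbb{Z}_{2n}\setminus\mathbb{Z}_n)$.
   Context: $\mathbb{Z}_m=\{0,\ldots,m-1\}$ as integers. For $g:\mathbb{Z}_n\to\mathbb{Z}_n$, $g^{(0)}=\mathrm{id}$, $g^{(j+1)}=g\circ g^{(j)}$; if $|g^{(n-1)}(\mathbb{Z}_n)|=1$, $g$ has a unique root $r$ with $g(r)=r$, $G_g$ is the directed graph on $\mathbb{Z}_n$ with edges $(v,g(v))$, and $d_g(v)$ is the least $j\ge0$ with $g^{(j)}(v)=r$. The left-to-right directed bipartite graph $\vec{G}_{g,g^\top}$ has vertex set $\mathbb{Z}_{2n}$ and directed edge set consisting of $(r,n+r)$ together with, for each $v\in\mathbb{Z}_n\setminus\{r\}$, the edge $(v,n+g(v))$ if $(-1)^{d_g(v)}=+1$ and the edge $(g(v),n+v)$ if $(-1)^{d_g(v)}=-1$. $\vec{K}_{n,n}$ is the directed graph on $\mathbb{Z}_{2n}$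 with edge set $\mathbb{Z}_n\times(\mathbb{Z}_{2n}\setminus\mathbb{Z}_n)$. -}

module Defs where

open import Data.Nat using (ℕ; zero; suc; _+_)
open import Data.Nat.DivMod using (_mod_)
open import Data.Fin using (Fin; toℕ)
open import Data.Fin.Properties using (_≟_)
open import Data.Integer as ℤ using (ℤ; +_; -_; _^_; -1ℤ; 1ℤ)
open import Data.Product using (Σ; _×_; ∃-syntax)
open import Data.Sum using (_⊎_)
open import Relation.Nullary using (¬_; yes; no)
open import Relation.Binary.PropositionalEquality using (_≡_; _≢_)

iter : ∀ {n} → (Fin n → Fin n) → ℕ → Fin n → Fin n
iter g zero    v = v
iter g (suc j) v = g (iter g j v)

-- least j ≤ fuel with g^(j)(v) = r, found by linear search
-- (returns fuel if none exists, which never happens under the hypothesis)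
depthSearch : ∀ {n} → (Fin n → Fin n) → Fin n → ℕ → Fin n → ℕ
depthSearch g r zero     v = zero
depthSearch g r (suc f)  v with v ≟ r
... | yes _ = zero
... | no  _ = suc (depthSearch g r f (g v))

-- d_g(v) : least j ≥ 0 with g^(j)(v) = r  (search bound n suffices
-- since g^(n-1)(v) = r for all v)
depth : ∀ {n} → (Fin n → Fin n) → Fin n → Fin n → ℕ
depth {n} g r v = depthSearch g r n v

signedDiff : ∀ {n} → (Fin n → Fin n) → Fin n → Fin n → ℤ
signedDiff g r v = (-1ℤ ^ depth g r v) ℤ.* ((+ toℕ (g v)) ℤ.- (+ toℕ v))

BetaLabeled : ∀ {n} → (Fin n → Fin n) → Fin n → Set
BetaLabeled {n} g r =
  (∀ (v : Fin n) → ∃[ k ] signedDiff g r v ≡ + toℕ {n} k)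
  × (∀ (k : Fin n) → ∃[ v ] signedDiff g r v ≡ + toℕ k)

-- Edge (x, n + y) of the directed bipartite tree G_{g,gᵀ}, encoded as a pair
-- (x , y) of elements of Z_n (left vertex x, right vertex n + y).
TreeEdge : ∀ {n} → (Fin n → Fin n) → Fin n → Fin n → Fin n → Set
TreeEdge g r x y =
  (x ≡ r × y ≡ r)
  ⊎ (∃[ v ] (v ≢ r) ×
       (((-1ℤ ^ depth g r v) ≡ 1ℤ × x ≡ v × y ≡ g v)
        ⊎ ((-1ℤ ^ depth g r v) ≡ -1ℤ × x ≡ g v × y ≡ v)))

addMod : ∀ {n} → Fin n → Fin n → Fin n
addMod {suc m} a i = (toℕ a + toℕ i) mod (suc m)

ShiftedEdge : ∀ {n} → (Fin n → Fin n) → Fin n → Fin n → Fin n → Fin n → Set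
ShiftedEdge g r i a b =
  ∃[ x ] ∃[ y ] TreeEdge g r x y × a ≡ addMod x i × b ≡ addMod y i

-- Each vertex v of the tree contributes one edge (x, n + y), oriented so that
-- y - x is the β-label (-1)^{d_g(v)} (g(v) - v); the root contributes (r, n + r)
-- with label 0. The labels are onto Z_n by hypothesis, hence one-to-one, so an edge
-- (a, n + b) of K_{n,n} determines its label b - a mod n, hence the contributing
-- vertex v, hence the left end x of the tree edge, hence the unique shift
-- i = a - x mod n; conversely this i does shift the edge of v onto (a, n + b).
module Submission where

open import Defs
open import Function using (_∘_)
open import Function.Definitions using (Injective)
open import Data.Nat using (ℕ; zero; suc; _+_; _∸_; _%_; _≤_; NonZero)
open import Data.Nat.Properties using (<⇒≤; +-comm; 1+n≰n; m+[n∸m]≡n; +-commutativeSemigroup)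
open import Algebra.Properties.CommutativeSemigroup +-commutativeSemigroup
  using (xy∙z≈xz∙y; xy∙z≈zx∙y)
open import Data.Nat.DivMod using (_mod_; %-distribˡ-+; m%n%n≡m%n; [m+n]%n≡m%n; m<n⇒m%n≡m)
open import Data.Fin using (Fin; zero; suc; toℕ)
open import Data.Fin.Properties using (toℕ-injective; toℕ<n; toℕ-fromℕ<; injective⇒≤; _≟_)
open import Data.Integer as ℤ using (+_; -1ℤ; 1ℤ)
import Data.Integer.Properties as ℤₚ
open import Algebra.Properties.AbelianGroup ℤₚ.+-0-abelianGroup using (xyx⁻¹≈y; ⁻¹-anti-homo‿-)
open import Data.Product using (_×_; ∃-syntax; _,_; proj₁; proj₂)
open import Data.Sum using (_⊎_; inj₁; inj₂; swap; map)
open import Relation.Nullary using (yes; no; contradiction)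
open import Relation.Binary.PropositionalEquality
open ≡-Reasoning

-1^n≡1⊎-1^n≡-1 : ∀ n → -1ℤ ℤ.^ n ≡ 1ℤ ⊎ -1ℤ ℤ.^ n ≡ -1ℤ
-1^n≡1⊎-1^n≡-1 zero    = inj₁ refl
-1^n≡1⊎-1^n≡-1 (suc n) = swap (map (cong (-1ℤ ℤ.*_)) (cong (-1ℤ ℤ.*_)) (-1^n≡1⊎-1^n≡-1 n))

[+n]-[+m]≡+k⇒m+k≡n : ∀ m n k → + n ℤ.- + m ≡ + k → m + k ≡ n
[+n]-[+m]≡+k⇒m+k≡n m n k eq = ℤₚ.+-injective (begin
  + (m + k)              ≡⟨ ℤₚ.pos-+ m k ⟩
  + m ℤ.+ + k            ≡⟨ cong (λ z → + m ℤ.+ z) eq ⟨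
  + m ℤ.+ (+ n ℤ.- + m)  ≡⟨ ℤₚ.+-assoc (+ m) (+ n) (ℤ.- + m) ⟨
  + m ℤ.+ + n ℤ.- + m    ≡⟨ xyx⁻¹≈y (+ m) (+ n) ⟩
  + n                    ∎)

surjective⇒injective : ∀ {n} (f : Fin n → Fin n) → (∀ k → ∃[ v ] f v ≡ k) →
                       Injective _≡_ _≡_ f
surjective⇒injective {n} f surj {v} {w} fv≡fw with v ≟ w
... | yes v≡w = v≡w
... | no  v≢w = contradiction (injective⇒≤ extend-injective) 1+n≰n
  where
  s : Fin n → Fin n
  s = proj₁ ∘ surj

  f∘s≡id : ∀ k → f (s k) ≡ k
  f∘s≡id = proj₂ ∘ surj

  s-injective : Injective _≡_ _≡_ s
  s-injective {k} {k′} eq = trans (sym (f∘s≡id k)) (trans (cong f eq) (f∘s≡id k′))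

  -- s (f v) = s (f w) cannot be both v and w.
  moved : ∃[ u ] u ≢ s (f u)
  moved with v ≟ s (f v)
  ... | no  v≢sfv = v , v≢sfv
  ... | yes v≡sfv = w , λ w≡sfw → v≢w (trans v≡sfv (trans (cong s fv≡fw) (sym w≡sfw)))

  u : Fin n
  u = proj₁ moved

  u∉image : ∀ k → s k ≢ u
  u∉image k sk≡u = proj₂ moved (begin
    u          ≡⟨ sk≡u ⟨
    s k        ≡⟨ cong s (f∘s≡id k) ⟨
    s (f (s k)) ≡⟨ cong (s ∘ f) sk≡u ⟩
    s (f u)    ∎)

  extend : Fin (suc n) → Fin n
  extend zero    = u
  extend (suc k) = s k

  extend-injective : Injective _≡_ _≡_ extend
  extend-injective {zero}  {zero}   _  = refl
  extend-injective {zero}  {suc k}  eq = contradiction (sym eq) (u∉image k)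
  extend-injective {suc k} {zero}   eq = contradiction eq (u∉image k)
  extend-injective {suc k} {suc k′} eq = cong suc (s-injective eq)

[m%d+n]%d≡[m+n]%d : ∀ m n d .{{_ : NonZero d}} → (m % d + n) % d ≡ (m + n) % d
[m%d+n]%d≡[m+n]%d m n d = begin
  (m % d + n) % d          ≡⟨ %-distribˡ-+ (m % d) n d ⟩
  (m % d % d + n % d) % d  ≡⟨ cong (λ z → (z + n % d) % d) (m%n%n≡m%n m d) ⟩
  (m % d + n % d) % d      ≡⟨ %-distribˡ-+ m n d ⟨
  (m + n) % d              ∎

m+k+[n∸m]≡k+n : ∀ m k n → m ≤ n → m + k + (n ∸ m) ≡ k + n
m+k+[n∸m]≡k+n m k n m≤n = begin
  m + k + (n ∸ m)    ≡⟨ xy∙z≈xz∙y m k (n ∸ m) ⟩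
  m + (n ∸ m) + k    ≡⟨ cong (_+ k) (m+[n∸m]≡n m≤n) ⟩
  n + k              ≡⟨ +-comm n k ⟩
  k + n              ∎

subMod : ∀ {n} → Fin n → Fin n → Fin n
subMod {suc m} a x = (toℕ a + (suc m ∸ toℕ x)) mod suc m

module _ {m : ℕ} where

  toℕ-addMod : (x i : Fin (suc m)) → toℕ (addMod x i) ≡ (toℕ x + toℕ i) % suc m
  toℕ-addMod x i = toℕ-fromℕ< _

  toℕ-subMod : (a x : Fin (suc m)) → toℕ (subMod a x) ≡ (toℕ a + (suc m ∸ toℕ x)) % suc m
  toℕ-subMod a x = toℕ-fromℕ< _

  toℕ%n≡toℕ : (x : Fin (suc m)) → toℕ x % suc m ≡ toℕ x
  toℕ%n≡toℕ x = m<n⇒m%n≡m (toℕ<n x)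

  [x+k+[n∸x]]%n≡k : (x k : Fin (suc m)) → (toℕ x + toℕ k + (suc m ∸ toℕ x)) % suc m ≡ toℕ k
  [x+k+[n∸x]]%n≡k x k = begin
    (toℕ x + toℕ k + (suc m ∸ toℕ x)) % suc m  ≡⟨ cong (_% suc m) (m+k+[n∸m]≡k+n _ _ _ (<⇒≤ (toℕ<n x))) ⟩
    (toℕ k + suc m) % suc m                    ≡⟨ [m+n]%n≡m%n (toℕ k) (suc m) ⟩
    toℕ k % suc m                              ≡⟨ toℕ%n≡toℕ k ⟩
    toℕ k                                      ∎

  subMod-addMod : (x i : Fin (suc m)) → subMod (addMod x i) x ≡ i
  subMod-addMod x i = toℕ-injective (begin
    toℕ (subMod (addMod x i) x)                         ≡⟨ toℕ-subMod (addMod x i) x ⟩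
    (toℕ (addMod x i) + (suc m ∸ toℕ x)) % suc m        ≡⟨ cong (λ z → (z + (suc m ∸ toℕ x)) % suc m) (toℕ-addMod x i) ⟩
    ((toℕ x + toℕ i) % suc m + (suc m ∸ toℕ x)) % suc m ≡⟨ [m%d+n]%d≡[m+n]%d (toℕ x + toℕ i) _ (suc m) ⟩
    (toℕ x + toℕ i + (suc m ∸ toℕ x)) % suc m           ≡⟨ [x+k+[n∸x]]%n≡k x i ⟩
    toℕ i                                               ∎)

  addMod-subMod : (x a : Fin (suc m)) → addMod x (subMod a x) ≡ a
  addMod-subMod x a = toℕ-injective (begin
    toℕ (addMod x (subMod a x))                         ≡⟨ toℕ-addMod x (subMod a x) ⟩
    (toℕ x + toℕ (subMod a x)) % suc m                  ≡⟨ cong (λ z → (toℕ x + z) % suc m) (toℕ-subMod a x) ⟩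
    (toℕ x + (toℕ a + (suc m ∸ toℕ x)) % suc m) % suc m ≡⟨ cong (_% suc m) (+-comm (toℕ x) _) ⟩
    ((toℕ a + (suc m ∸ toℕ x)) % suc m + toℕ x) % suc m ≡⟨ [m%d+n]%d≡[m+n]%d (toℕ a + (suc m ∸ toℕ x)) (toℕ x) (suc m) ⟩
    (toℕ a + (suc m ∸ toℕ x) + toℕ x) % suc m           ≡⟨ cong (_% suc m) (xy∙z≈zx∙y (toℕ a) _ (toℕ x)) ⟩
    (toℕ x + toℕ a + (suc m ∸ toℕ x)) % suc m           ≡⟨ [x+k+[n∸x]]%n≡k x a ⟩
    toℕ a                                               ∎)

  addMod-cancelˡ : (x : Fin (suc m)) {i j : Fin (suc m)} → addMod x i ≡ addMod x j → i ≡ j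
  addMod-cancelˡ x {i} {j} eq = begin
    i                     ≡⟨ subMod-addMod x i ⟨
    subMod (addMod x i) x ≡⟨ cong (λ a → subMod a x) eq ⟩
    subMod (addMod x j) x ≡⟨ subMod-addMod x j ⟩
    j                     ∎

  addMod-rightComm : (x i j : Fin (suc m)) → addMod (addMod x i) j ≡ addMod (addMod x j) i
  addMod-rightComm x i j = toℕ-injective (begin
    toℕ (addMod (addMod x i) j)          ≡⟨ toℕ-addMod (addMod x i) j ⟩
    (toℕ (addMod x i) + toℕ j) % suc m   ≡⟨ cong (λ z → (z + toℕ j) % suc m) (toℕ-addMod x i) ⟩
    ((toℕ x + toℕ i) % suc m + toℕ j) % suc m ≡⟨ [m%d+n]%d≡[m+n]%d (toℕ x + toℕ i) (toℕ j) (suc m) ⟩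
    (toℕ x + toℕ i + toℕ j) % suc m      ≡⟨ cong (_% suc m) (xy∙z≈xz∙y (toℕ x) (toℕ i) (toℕ j)) ⟩
    (toℕ x + toℕ j + toℕ i) % suc m      ≡⟨ [m%d+n]%d≡[m+n]%d (toℕ x + toℕ j) (toℕ i) (suc m) ⟨
    ((toℕ x + toℕ j) % suc m + toℕ i) % suc m ≡⟨ cong (λ z → (z + toℕ i) % suc m) (toℕ-addMod x j) ⟨
    (toℕ (addMod x j) + toℕ i) % suc m   ≡⟨ toℕ-addMod (addMod x j) i ⟨
    toℕ (addMod (addMod x j) i)          ∎)

  toℕ-+⇒addMod : (x k : Fin (suc m)) {y : Fin (suc m)} → toℕ x + toℕ k ≡ toℕ y → addMod x k ≡ y
  toℕ-+⇒addMod x k {y} eq = toℕ-injective (begin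
    toℕ (addMod x k)         ≡⟨ toℕ-addMod x k ⟩
    (toℕ x + toℕ k) % suc m  ≡⟨ cong (_% suc m) eq ⟩
    toℕ y % suc m            ≡⟨ toℕ%n≡toℕ y ⟩
    toℕ y                    ∎)

-- The edge of the tree contributed by v. The root contributes (r, n + r) in both
-- orientations, which is consistent because g r = r.
VertexEdge : ∀ {n} → (Fin n → Fin n) → Fin n → Fin n → Fin n → Fin n → Set
VertexEdge g r v x y =
    (-1ℤ ℤ.^ depth g r v ≡ 1ℤ × x ≡ v × y ≡ g v)
  ⊎ (-1ℤ ℤ.^ depth g r v ≡ -1ℤ × x ≡ g v × y ≡ v)

module _ {n} {g : Fin n → Fin n} {r : Fin n} where

  vertexEdge-functional : ∀ {v x y x′ y′} → VertexEdge g r v x y → VertexEdge g r v x′ y′ → x ≡ x′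
  vertexEdge-functional (inj₁ (_ , refl , _)) (inj₁ (_ , refl , _)) = refl
  vertexEdge-functional (inj₂ (_ , refl , _)) (inj₂ (_ , refl , _)) = refl
  vertexEdge-functional (inj₁ (even , _)) (inj₂ (odd , _)) with () ← trans (sym even) odd
  vertexEdge-functional (inj₂ (odd , _)) (inj₁ (even , _)) with () ← trans (sym even) odd

  signedDiff-vertexEdge : ∀ {v x y} → VertexEdge g r v x y → signedDiff g r v ≡ + toℕ y ℤ.- + toℕ x
  signedDiff-vertexEdge (inj₁ (even , refl , refl)) =
    trans (cong (ℤ._* _) even) (ℤₚ.*-identityˡ _)
  signedDiff-vertexEdge {v} (inj₂ (odd , refl , refl)) =
    trans (cong (ℤ._* _) odd) (trans (ℤₚ.-1*i≡-i _) (⁻¹-anti-homo‿- (+ toℕ (g v)) (+ toℕ v)))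

  module _ (g-fixes-r : g r ≡ r) where

    rootEdge : VertexEdge g r r r r
    rootEdge with -1^n≡1⊎-1^n≡-1 (depth g r r)
    ... | inj₁ even = inj₁ (even , refl , sym g-fixes-r)
    ... | inj₂ odd  = inj₂ (odd , sym g-fixes-r , refl)

    treeEdge⇒vertexEdge : ∀ {x y} → TreeEdge g r x y → ∃[ v ] VertexEdge g r v x y
    treeEdge⇒vertexEdge (inj₁ (refl , refl)) = r , rootEdge
    treeEdge⇒vertexEdge (inj₂ (v , _ , e))   = v , e

    vertexEdge⇒treeEdge : ∀ v → ∃[ x ] ∃[ y ] VertexEdge g r v x y × TreeEdge g r x y
    vertexEdge⇒treeEdge v with v ≟ r
    ... | yes refl = r , r , rootEdge , inj₁ (refl , refl)
    ... | no  v≢r with -1^n≡1⊎-1^n≡-1 (depth g r v)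
    ...   | inj₁ even = v , g v , inj₁ (even , refl , refl) , inj₂ (v , v≢r , inj₁ (even , refl , refl))
    ...   | inj₂ odd  = g v , v , inj₂ (odd , refl , refl) , inj₂ (v , v≢r , inj₂ (odd , refl , refl))

iter-commute : ∀ {n} (g : Fin n → Fin n) j v → iter g j (g v) ≡ g (iter g j v)
iter-commute g zero    v = refl
iter-commute g (suc j) v = cong g (iter-commute g j v)

iter-const⇒fixed : ∀ {n} (g : Fin n → Fin n) {r} j → (∀ v → iter g j v ≡ r) → g r ≡ r
iter-const⇒fixed g {r} j iter≡r = begin
  g r              ≡⟨ cong g (iter≡r r) ⟨
  g (iter g j r)   ≡⟨ iter-commute g j r ⟨
  iter g j (g r)   ≡⟨ iter≡r (g r) ⟩
  r                ∎

module Decomposition {m} {g : Fin (suc m) → Fin (suc m)} {r : Fin (suc m)}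
                     (g-fixes-r : g r ≡ r) (β : BetaLabeled g r) where

  label : Fin (suc m) → Fin (suc m)
  label v = proj₁ (proj₁ β v)

  signedDiff≡label : ∀ v → signedDiff g r v ≡ + toℕ (label v)
  signedDiff≡label v = proj₂ (proj₁ β v)

  label-surjective : ∀ k → ∃[ v ] label v ≡ k
  label-surjective k with v , eq ← proj₂ β k =
    v , toℕ-injective (ℤₚ.+-injective (trans (sym (signedDiff≡label v)) eq))

  label-injective : Injective _≡_ _≡_ label
  label-injective = surjective⇒injective label label-surjective

  vertexEdge-label : ∀ {v x y} → VertexEdge g r v x y → addMod x (label v) ≡ y
  vertexEdge-label {v} {x} {y} e =
    toℕ-+⇒addMod x (label v) ([+n]-[+m]≡+k⇒m+k≡n (toℕ x) (toℕ y) (toℕ (label v))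
      (trans (sym (signedDiff-vertexEdge e)) (signedDiff≡label v)))

  shiftedEdge-label : ∀ {i a b} → ShiftedEdge g r i a b →
    ∃[ v ] ∃[ x ] (∃[ y ] VertexEdge g r v x y) × addMod x i ≡ a × addMod a (label v) ≡ b
  shiftedEdge-label {i} (x , y , t , refl , refl) with v , e ← treeEdge⇒vertexEdge g-fixes-r t =
    v , x , (y , e) , refl , (begin
      addMod (addMod x i) (label v) ≡⟨ addMod-rightComm x i (label v) ⟩
      addMod (addMod x (label v)) i ≡⟨ cong (λ z → addMod z i) (vertexEdge-label e) ⟩
      addMod y i                    ∎)

  shiftedEdge-unique : ∀ i j a b → ShiftedEdge g r i a b → ShiftedEdge g r j a b → i ≡ j
  shiftedEdge-unique i j a b sᵢ sⱼ
    with v , x , (_ , e) , xi≡a , aℓ≡b ← shiftedEdge-label sᵢ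
       | v′ , x′ , (_ , e′) , x′j≡a , aℓ′≡b ← shiftedEdge-label sⱼ
    with refl ← label-injective (addMod-cancelˡ a (trans aℓ≡b (sym aℓ′≡b)))
    with refl ← vertexEdge-functional e e′
    = addMod-cancelˡ x (trans xi≡a (sym x′j≡a))

  shiftedEdge-exists : ∀ a b → ∃[ i ] ShiftedEdge g r i a b
  shiftedEdge-exists a b
    with v , ℓ≡b-a ← label-surjective (subMod b a)
    with x , y , e , t ← vertexEdge⇒treeEdge g-fixes-r v
    = subMod a x , x , y , t , sym (addMod-subMod x a) , sym (begin
      addMod y (subMod a x)                        ≡⟨ cong (λ z → addMod z (subMod a x)) (vertexEdge-label e) ⟨
      addMod (addMod x (label v)) (subMod a x)     ≡⟨ addMod-rightComm x (label v) (subMod a x) ⟩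
      addMod (addMod x (subMod a x)) (label v)     ≡⟨ cong₂ addMod (addMod-subMod x a) ℓ≡b-a ⟩
      addMod a (subMod b a)                        ≡⟨ addMod-subMod a b ⟩
      b                                            ∎)

proposition5p3 : (n : ℕ) (g : Fin n → Fin n) (r : Fin n)
    → (∀ v → iter g (n ∸ 1) v ≡ r)
    → BetaLabeled g r
    → (∀ i j a b → ShiftedEdge g r i a b → ShiftedEdge g r j a b → i ≡ j)
    × (∀ a b → ∃[ i ] ShiftedEdge g r i a b)
proposition5p3 zero    g ()
proposition5p3 (suc m) g r iter≡r β = shiftedEdge-unique , shiftedEdge-exists
  where open Decomposition (iter-const⇒fixed g m iter≡r) β
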